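{- Let $\sigma$ be a permutation and $F$ the binary indexed forest with $\mathrm{code}(F)=\mathrm{code}(\sigma)$. Let $a,b\in\mathrm{IN}(F)$ with $b$ the right child of $a$, and suppose $(c_a,c_b)$ is a bad parent-child pair. If, starting from $P_{\mathrm{bott}}(\sigma)$, the crossing $c_b$ can be moved by simple ladder moves into the row of $c_a$ without any other crossing making any simple ladder move, then $\sigma$ contains one of the patterns $2413$, $2431$, $32154$, $341265$.
   Context: Pattern containment: $\sigma$ contains $\pi\in S_n$ if there are indices $i_1<\dots<i_n$ with $\sigma(i_1),\dots,\sigma(i_n)$ in the same relative order as $\pi(1),\dots,\pi(n)$. Lehmer code: $\mathrm{code}(\sigma)=(L(1),L(2),\dots)$, $L(i)=\#\{j>i:\sigma(j)<\sigma(i)\}$. Binary indexed forest $F$ supported on a finite $S\subset\mathbb{Z}_{>0}$: a full binary tree for each maximal interval of consecutive integers of $S$, leaves left to right attached to the integers of that interval. $\mathrm{IN}(F)$: interior vertices; $\rho_F(v)$: leaf label reached from $v$ by following left-child edges; $\mathrm{code}(F)=(L_F(i))_i$, $L_F(i)=\#\{v:\rho_F(v)=i\}$. Pipe dreams: a reduced pipe dream for $\sigma$ is a finite set of cells $(r,c)$ (row $r$ numbered top to bottom, column $c$), called crossings, whose associated word of transpositions $s_{r+c-1}$ read in the standard order is a reduced word for $\sigma$. The cell $(r,c)$ lies on northeast diagonal $r+c-1$. $P_{\mathrm{bott}}(\sigma)$ is the pipe dream $\{(i,c):1\le c\le L(i)\}$. A simple ladder move replaces a crossing $(r,c)$ by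 $(r-1,c+1)$ when $(r-1,c),(r-1,c+1),(r,c+1)$ are not crossings. Correspondence: number crossings in row $i$ of $P_{\mathrm{bott}}(\sigma)$ as $1,\dots,L(i)$ left to right and vertices $v$ with $\rho_F(v)=i$ as $1,\dots,L_F(i)$ bottom to top; $c_v$ denotes the crossing with the same row $i$ and number as $v$. For $a,b\in\mathrm{IN}(F)$ with $b$ the right child of $a$, the pair $(c_a,c_b)$ is a bad parent-child pair if some sequence of simple ladder moves applied to $P_{\mathrm{bott}}(\sigma)$ (moving $c_b$ or other crossings) produces a pipe dream in which $c_b$ lies in the same row as $c_a$. -}

module Defs where

open import Data.Nat using (ℕ; zero; suc; _+_; _≟_)
import Data.Nat as ℕ
open import Data.Fin using (Fin; fromℕ<)
import Data.Fin as Fin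
open import Data.Fin.Permutation using (Permutation′; _⟨$⟩ʳ_)
open import Data.List using (List; []; _∷_; map; _++_; filter; length; upTo; allFin; concatMap)
open import Data.List.Relation.Unary.Any using (Any)
open import Data.List.Relation.Unary.All using (All)
open import Data.List.Membership.Propositional using (_∈_)
open import Data.Vec using (Vec; lookup)
open import Data.Product using (Σ; _×_; _,_; proj₁)
open import Data.Sum using (_⊎_)
open import Relation.Nullary using (¬_; yes; no)
open import Relation.Nullary.Decidable using (_×-dec_)
open import Relation.Binary.PropositionalEquality using (_≡_; _≢_)
open import Function.Bundles using (_⇔_)

-- Permutations, Lehmer code, pattern containment
-- σ ∈ S_n is a Permutation′ n; position i : Fin n stands for the
-- integer toℕ i + 1.

lehmer : ∀ {n} → Permutation′ n → Fin n → ℕ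
lehmer {n} σ i =
  length (filter (λ j → (i Fin.<? j) ×-dec ((σ ⟨$⟩ʳ j) Fin.<? (σ ⟨$⟩ʳ i))) (Data.List.allFin n))

-- code(σ) as a sequence indexed by positive integers (code σ 0 = 0 is
-- a dummy value; L(i) = 0 for i > n).
code : ∀ {n} → Permutation′ n → ℕ → ℕ
code σ zero = 0
code {n} σ (suc k) with k ℕ.<? n
... | yes k<n = lehmer σ (fromℕ< k<n)
... | no _ = 0

Contains : ∀ {n k} → Permutation′ n → Vec ℕ k → Set
Contains {n} {k} σ π =
  Σ (Fin k → Fin n) λ f →
    (∀ p q → p Fin.< q → f p Fin.< f q) ×
    (∀ p q → ((σ ⟨$⟩ʳ f p) Fin.< (σ ⟨$⟩ʳ f q)) ⇔ (lookup π p ℕ.< lookup π q))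

data Tree : Set where
  leaf : Tree
  node : Tree → Tree → Tree

leaves : Tree → ℕ
leaves leaf = 1
leaves (node l r) = leaves l + leaves r

-- interior vertices of a tree, addressed by paths from the root
data Path : Tree → Set where
  here : ∀ {l r} → Path (node l r)
  goL  : ∀ {l r} → Path l → Path (node l r)
  goR  : ∀ {l r} → Path r → Path (node l r)

data RightChildP : {t : Tree} → Path t → Path t → Set where
  rc-here : ∀ {l rl rr} → RightChildP {node l (node rl rr)} here (goR here)
  rc-L    : ∀ {l r} {a b : Path l} → RightChildP a b → RightChildP {node l r} (goL a) (goL b)
  rc-R    : ∀ {l r} {a b : Path r} → RightChildP a b → RightChildP {node l r} (goR a) (goR b)

-- offset (0-based) of the leaf reached from a vertex by left-child edges
offsetP : {t : Tree} → Path t → ℕ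
offsetP here = 0
offsetP (goL p) = offsetP p
offsetP (goR {l} p) = leaves l + offsetP p

leftDepth : Tree → ℕ
leftDepth leaf = 0
leftDepth (node l r) = suc (leftDepth l)

-- number of left-child edges from an interior vertex down to ρ_F(v);
-- this is exactly the bottom-to-top number of v among {w : ρ_F(w) = ρ_F(v)}
levelP : {t : Tree} → Path t → ℕ
levelP (here {l}) = suc (leftDepth l)
levelP (goL p) = levelP p
levelP (goR p) = levelP p

allPaths : (t : Tree) → List (Path t)
allPaths leaf = []
allPaths (node l r) = here ∷ (map goL (allPaths l) ++ map goR (allPaths r))

-- A binary indexed forest, listed left to right as (gap , tree).
-- With base b (the last position already used, initially 0), the tree
-- occupies leaves b+1+gap , … , b+gap+leaves t; the next base is
-- b+gap+leaves t+1, so consecutive trees are separated by at least one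
-- missing integer (maximal intervals) and all leaves are positive.
-- Every binary indexed forest has exactly one such description.
Forest : Set
Forest = List (ℕ × Tree)

data Vertex : ℕ → Forest → Set where
  inHere  : ∀ {b g t F} → Path t → Vertex b ((g , t) ∷ F)
  inLater : ∀ {b g t F} → Vertex (b + g + leaves t + 1) F → Vertex b ((g , t) ∷ F)

IN : Forest → Set
IN F = Vertex 0 F

ρV : ∀ {b F} → Vertex b F → ℕ
ρV {b} (inHere {g = g} p) = b + suc g + offsetP p
ρV (inLater v) = ρV v

levelV : ∀ {b F} → Vertex b F → ℕ
levelV (inHere p) = levelP p
levelV (inLater v) = levelV v

data RightChildV : ∀ {b F} → Vertex b F → Vertex b F → Set where
  rcv-here  : ∀ {b g t F} {p q : Path t} → RightChildP p q →
              RightChildV {b} {(g , t) ∷ F} (inHere p) (inHere q)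
  rcv-later : ∀ {b g t F} {v w : Vertex (b + g + leaves t + 1) F} → RightChildV v w →
              RightChildV {b} {(g , t) ∷ F} (inLater v) (inLater w)

allV : (b : ℕ) (F : Forest) → List (Vertex b F)
allV b [] = []
allV b ((g , t) ∷ F) = map inHere (allPaths t) ++ map inLater (allV (b + g + leaves t + 1) F)

ρ : ∀ {F} → IN F → ℕ
ρ = ρV

codeF : Forest → ℕ → ℕ
codeF F i = length (filter (λ v → ρV v ≟ i) (allV 0 F))

-- a cell (row , column), 1-based
Cell : Set
Cell = ℕ × ℕ

Pbott : ∀ {n} → Permutation′ n → List Cell
Pbott {n} σ =
  concatMap (λ i → map (λ c → (i , c)) (map suc (upTo (code σ i)))) (map suc (upTo n))

cross : ∀ {F} → IN F → Cell
cross v = (ρV v , levelV v)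

-- A configuration tracks where each crossing of P_bott currently sits:
-- crossing x (named by its original cell) is at cell pos x.
Config : Set
Config = Cell → Cell

Occ : List Cell → Config → Cell → Set
Occ P pos c = Any (λ y → pos y ≡ c) P

data LadderMove (P : List Cell) (pos : Config) (x : Cell) (pos' : Config) : Set where
  ladder : (r c : ℕ) → x ∈ P →
           pos x ≡ (suc (suc r) , c) →
           ¬ Occ P pos (suc r , c) →
           ¬ Occ P pos (suc r , suc c) →
           ¬ Occ P pos (suc (suc r) , suc c) →
           pos' x ≡ (suc r , suc c) →
           (∀ y → y ≢ x → pos' y ≡ pos y) →
           LadderMove P pos x pos'

data Moves (P : List Cell) : Config → List Cell → Config → Set where
  done : ∀ {pos} → Moves P pos [] pos
  step : ∀ {pos pos₁ pos₂ x xs} → LadderMove P pos x pos₁ → Moves P pos₁ xs pos₂ →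
         Moves P pos (x ∷ xs) pos₂

startConfig : Config
startConfig c = c

BadPair : ∀ {n F} → Permutation′ n → IN F → IN F → Set
BadPair σ a b =
  Σ (List Cell) λ ms → Σ Config λ pos →
    Moves (Pbott σ) startConfig ms pos × (proj₁ (pos (cross b)) ≡ proj₁ (pos (cross a)))

OnlyBMoves : ∀ {n F} → Permutation′ n → IN F → IN F → Set
OnlyBMoves σ a b =
  Σ (List Cell) λ ms → Σ Config λ pos →
    All (λ x → x ≡ cross b) ms ×
    Moves (Pbott σ) startConfig ms pos × (proj₁ (pos (cross b)) ≡ proj₁ (pos (cross a)))

-- Let i = ρ(a) < j = ρ(b) and let q be the column of c_b. As c_b climbs alone along
-- its antidiagonal from row j to row i, the cell above it is free in every row r it
-- enters, so r + 1 + L(r) < j + q for i ≤ r < j. On the forest side, a and the interior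
-- vertices of its left subtree give at least j - i vertices with ρ in [i, j), so
-- L(i) + ... + L(j - 1) ≥ j - i.
--
-- Let T be the entries after position j that are smaller than σ(j); |T| = L(j) ≥ q.
-- Going from r = j - 1 down to i, the bound on L(r) forces σ(r) < σ(j) and σ(r) < min T,
-- unless σ(r), σ(j) and two entries of T form 2413 or 2431. Then L(r) counts only
-- inversions inside the window [i, j), which therefore has at least as many inversions
-- as entries and contains 321 or 3412; appending σ(j) and an entry of T yields 32154
-- or 341265.

module Submission where

open import Defs
open import Data.Fin using (Fin; toℕ; fromℕ<; #_)
import Data.Fin as Fin
open import Data.Fin.Properties using (toℕ-fromℕ<; fromℕ<-toℕ; toℕ-injective; toℕ<n; all?)
import Data.Fin.Properties as Fin
open import Data.Fin.Permutation using (Permutation′; _⟨$⟩ʳ_; _⟨$⟩ˡ_; inverseˡ)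
open import Data.Vec as Vec using (Vec; []; _∷_; lookup; _∷ʳ_)
open import Data.Vec.Properties using (lookup-map)
open import Data.Vec.Relation.Unary.Linked using (Linked; []; [-]; _∷_)
open import Data.Vec.Relation.Unary.Linked.Properties using (lookup⁺)
import Data.Vec.Relation.Unary.All as VecAll
open import Data.Vec.Relation.Unary.All using ([]; _∷_)
import Data.Vec.Relation.Unary.All.Properties as VecAll
open import Relation.Binary.Core using (Rel)
open import Relation.Binary.Definitions using (Transitive; tri<; tri≈; tri>)
open import Function.Bundles using (mk⇔)
open import Data.Nat
  using (ℕ; zero; suc; _+_; _∸_; _≤_; _<_; z≤n; s≤s; z<s; s≤s⁻¹; s<s⁻¹; _≤?_; _<?_; _≟_)
open import Data.Nat.Properties
open import Data.List using (List; []; _∷_; _++_; map; length; filter; tabulate; allFin; upTo)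
open import Data.Nat.ListAction using (sum)
open import Data.List.Properties
  using (map-tabulate; map-++; map-∘; map-cong; length-map; length-++; length-filter; filter-all; filter-none)
open import Data.List.Relation.Unary.All as All using (All; []; _∷_)
open import Data.List.Relation.Unary.AllPairs using (AllPairs; []; _∷_)
open import Data.List.Relation.Unary.Any as Any using (here; there; any?)
open import Data.List.Membership.Propositional using (_∈_; find; lose)
open import Data.List.Membership.Propositional.Properties
  using (∈-map⁺; ∈-map⁻; ∈-concatMap⁺; ∈-concatMap⁻; ∈-upTo⁺; ∈-upTo⁻)
open import Data.List.Relation.Binary.Subset.Propositional using (_⊆_)
open import Data.List.Relation.Binary.Subset.Propositional.Properties using (∷⁺ʳ)
open import Data.Product using (∃; _×_; _,_; proj₁; proj₂)
open import Data.Sum using (_⊎_; inj₁; inj₂)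
import Data.Sum as Sum
open import Data.Empty using (⊥; ⊥-elim)
open import Relation.Nullary using (¬_; Dec; yes; no)
open import Relation.Nullary.Decidable using (_×-dec_; True; toWitness)
open import Relation.Unary using (Pred; Decidable)
open import Function using (_∘_; id)
open import Function.Definitions using (Injective)
open import Data.Nat.Induction using (<-wellFounded)
open import Induction.WellFounded using (Acc; acc)
open import Level using (0ℓ)
open import Relation.Binary.PropositionalEquality
  using (_≡_; _≢_; refl; sym; trans; cong; cong₂; subst; subst₂; module ≡-Reasoning)

module _ {a p} {A : Set a} {P : Pred A p} (P? : Decidable P) where

  count : List A → ℕ
  count [] = 0
  count (x ∷ xs) with P? x
  ... | yes _ = suc (count xs)
  ... | no _ = count xs

  length-filter≡count : ∀ xs → length (filter P? xs) ≡ count xs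
  length-filter≡count [] = refl
  length-filter≡count (x ∷ xs) with P? x
  ... | yes _ = cong suc (length-filter≡count xs)
  ... | no _ = length-filter≡count xs

  count-++ : ∀ xs ys → count (xs ++ ys) ≡ count xs + count ys
  count-++ [] ys = refl
  count-++ (x ∷ xs) ys with P? x
  ... | yes _ = cong suc (count-++ xs ys)
  ... | no _ = count-++ xs ys

  count-≤-++ˡ : ∀ xs ys → count xs ≤ count (xs ++ ys)
  count-≤-++ˡ xs ys = subst (count xs ≤_) (sym (count-++ xs ys)) (m≤m+n _ _)

  count-≤-++ʳ : ∀ xs ys → count ys ≤ count (xs ++ ys)
  count-≤-++ʳ xs ys = subst (count ys ≤_) (sym (count-++ xs ys)) (m≤n+m _ _)

  count-≤-∷ : ∀ x xs → count xs ≤ count (x ∷ xs)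
  count-≤-∷ x xs with P? x
  ... | yes _ = n≤1+n _
  ... | no _ = ≤-refl

  count-∷-mono : ∀ x {xs ys} → count xs ≤ count ys → count (x ∷ xs) ≤ count (x ∷ ys)
  count-∷-mono x le with P? x
  ... | yes _ = s≤s le
  ... | no _ = le

  count-accept : ∀ {x xs} → P x → count (x ∷ xs) ≡ suc (count xs)
  count-accept {x} px with P? x
  ... | yes _ = refl
  ... | no ¬px = ⊥-elim (¬px px)

  count≤length : ∀ xs → count xs ≤ length xs
  count≤length xs = subst (_≤ length xs) (length-filter≡count xs) (length-filter P? xs)

  count-all : ∀ xs → (∀ {x} → x ∈ xs → P x) → count xs ≡ length xs
  count-all xs h = trans (sym (length-filter≡count xs)) (cong length (filter-all P? (All.tabulate h)))

  count-none : ∀ xs → (∀ {x} → x ∈ xs → ¬ P x) → count xs ≡ 0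
  count-none xs h = trans (sym (length-filter≡count xs)) (cong length (filter-none P? (All.tabulate h)))

  count>0⇒∃ : ∀ xs → 0 < count xs → ∃ λ x → x ∈ xs × P x
  count>0⇒∃ (x ∷ xs) c with P? x
  ... | yes px = x , here refl , px
  ... | no _ with count>0⇒∃ xs c
  ...   | y , y∈xs , py = y , there y∈xs , py

module _ {a p q} {A : Set a} {P : Pred A p} {Q : Pred A q} (P? : Decidable P) (Q? : Decidable Q) where

  count-mono : ∀ xs → (∀ {x} → x ∈ xs → P x → Q x) → count P? xs ≤ count Q? xs
  count-mono [] h = z≤n
  count-mono (x ∷ xs) h with P? x | Q? x
  ... | yes _  | yes _  = s≤s (count-mono xs (h ∘ there))
  ... | yes px | no ¬qx = ⊥-elim (¬qx (h (here refl) px))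
  ... | no _   | yes _  = m≤n⇒m≤1+n (count-mono xs (h ∘ there))
  ... | no _   | no _   = count-mono xs (h ∘ there)

module _ {a p q} {A : Set a} {P : Pred A p} {Q : Pred A q} (P? : Decidable P) (Q? : Decidable Q) where

  count-cong : ∀ xs → (∀ {x} → x ∈ xs → P x → Q x) → (∀ {x} → x ∈ xs → Q x → P x) →
               count P? xs ≡ count Q? xs
  count-cong xs P⇒Q Q⇒P = ≤-antisym (count-mono P? Q? xs P⇒Q) (count-mono Q? P? xs Q⇒P)

module _ {a b q} {A : Set a} {B : Set b} {Q : Pred B q} (Q? : Decidable Q) where

  count-map : ∀ (g : A → B) xs → count Q? (map g xs) ≡ count (Q? ∘ g) xs
  count-map g [] = refl
  count-map g (x ∷ xs) with Q? (g x)
  ... | yes _ = cong suc (count-map g xs)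
  ... | no _ = count-map g xs

module _ {a p q r} {A : Set a} {P : Pred A p} {Q : Pred A q} {R : Pred A r}
         (P? : Decidable P) (Q? : Decidable Q) (R? : Decidable R) where

  count-⊎ : ∀ xs → (∀ {x} → P x → Q x ⊎ R x) → count P? xs ≤ count Q? xs + count R? xs
  count-⊎ [] h = z≤n
  count-⊎ (x ∷ xs) h with P? x
  ... | no _ = ≤-trans (count-⊎ xs h) (+-mono-≤ (count-≤-∷ Q? x xs) (count-≤-∷ R? x xs))
  ... | yes px with h px
  ...   | inj₁ qx = begin
    suc (count P? xs)                          ≤⟨ s≤s (count-⊎ xs h) ⟩
    suc (count Q? xs + count R? xs)            ≤⟨ s≤s (+-monoʳ-≤ (count Q? xs) (count-≤-∷ R? x xs)) ⟩
    suc (count Q? xs) + count R? (x ∷ xs)      ≡⟨ cong (_+ count R? (x ∷ xs)) (count-accept Q? qx) ⟨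
    count Q? (x ∷ xs) + count R? (x ∷ xs)      ∎
    where open ≤-Reasoning
  ...   | inj₂ rx = begin
    suc (count P? xs)                          ≤⟨ s≤s (count-⊎ xs h) ⟩
    suc (count Q? xs + count R? xs)            ≤⟨ s≤s (+-monoˡ-≤ (count R? xs) (count-≤-∷ Q? x xs)) ⟩
    suc (count Q? (x ∷ xs) + count R? xs)      ≡⟨ +-suc (count Q? (x ∷ xs)) (count R? xs) ⟨
    count Q? (x ∷ xs) + suc (count R? xs)      ≡⟨ cong (count Q? (x ∷ xs) +_) (count-accept R? rx) ⟨
    count Q? (x ∷ xs) + count R? (x ∷ xs)      ∎
    where open ≤-Reasoning

range : ℕ → ℕ → List ℕ
range a zero = []
range a (suc k) = a ∷ range (suc a) k

length-range : ∀ a k → length (range a k) ≡ k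
length-range a zero = refl
length-range a (suc k) = cong suc (length-range (suc a) k)

range-++ : ∀ a k l → range a (k + l) ≡ range a k ++ range (a + k) l
range-++ a zero l = cong (λ z → range z l) (sym (+-identityʳ a))
range-++ a (suc k) l =
  cong (a ∷_) (trans (range-++ (suc a) k l) (cong (λ z → range (suc a) k ++ range z l) (sym (+-suc a k))))

∈-range⁻ : ∀ {a k x} → x ∈ range a k → a ≤ x × x < a + k
∈-range⁻ {a} {suc k} (here refl) = ≤-refl , m<m+n a (s≤s z≤n)
∈-range⁻ {a} {suc k} {x} (there m) with ∈-range⁻ m
... | a<x , x<a+1+k = <⇒≤ a<x , subst (x <_) (sym (+-suc a k)) x<a+1+k

map-suc-range : ∀ a k → map suc (range a k) ≡ range (suc a) k
map-suc-range a zero = refl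
map-suc-range a (suc k) = cong (suc a ∷_) (map-suc-range (suc a) k)

range-increasing : ∀ a k → AllPairs _<_ (range a k)
range-increasing a zero = []
range-increasing a (suc k) = All.tabulate (proj₁ ∘ ∈-range⁻) ∷ range-increasing (suc a) k

between? : ∀ lo hi → Decidable (λ x → lo ≤ x × x < hi)
between? lo hi x = (lo ≤? x) ×-dec (x <? hi)

count-between-shift : ∀ K lo hi xs → count (between? (K + lo) (K + hi)) (map (K +_) xs) ≡ count (between? lo hi) xs
count-between-shift K lo hi xs = trans (count-map (between? (K + lo) (K + hi)) (K +_) xs)
  (count-cong _ _ xs (λ _ (lo≤ , <hi) → +-cancelˡ-≤ K _ _ lo≤ , +-cancelˡ-< K _ _ <hi)
                     (λ _ (lo≤ , <hi) → +-monoʳ-≤ K lo≤ , +-monoʳ-< K <hi))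

count-between≤sum : ∀ xs lo k → count (between? lo (lo + k)) xs ≤ sum (map (λ r → count (_≟ r) xs) (range lo k))
count-between≤sum xs lo zero =
  ≤-reflexive (count-none _ xs λ _ (lo≤x , x<lo+0) → <⇒≱ x<lo+0 (subst (_≤ _) (sym (+-identityʳ lo)) lo≤x))
count-between≤sum xs lo (suc k) = begin
  count (between? lo (lo + suc k)) xs
    ≤⟨ count-⊎ _ _ _ xs split ⟩
  count (_≟ lo) xs + count (between? (suc lo) (suc lo + k)) xs
    ≤⟨ +-monoʳ-≤ _ (count-between≤sum xs (suc lo) k) ⟩
  count (_≟ lo) xs + sum (map (λ r → count (_≟ r) xs) (range (suc lo) k)) ∎
  where
  open ≤-Reasoning
  split : ∀ {x} → lo ≤ x × x < lo + suc k → x ≡ lo ⊎ (suc lo ≤ x × x < suc lo + k)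
  split {x} (lo≤x , x<) with lo ≟ x
  ... | yes refl = inj₁ refl
  ... | no lo≢x = inj₂ (≤∧≢⇒< lo≤x lo≢x , subst (x <_) (+-suc lo k) x<)

module _ (f : ℕ → ℕ) where

  LaterSmaller : ℕ → ℕ → Set
  LaterSmaller r t = r < t × f t < f r

  laterSmaller? : ∀ r → Decidable (LaterSmaller r)
  laterSmaller? r t = (r <? t) ×-dec (f t <? f r)

  lehmerℕ : ℕ → ℕ → ℕ
  lehmerℕ n r = count (laterSmaller? r) (range 0 n)

  lehmerℕ-suffix : ∀ n r k → suc r + k ≡ n → lehmerℕ n r ≡ count (laterSmaller? r) (range (suc r) k)
  lehmerℕ-suffix n r k r+k≡n = begin
    count (laterSmaller? r) (range 0 n)
      ≡⟨ cong (count (laterSmaller? r) ∘ range 0) r+k≡n ⟨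
    count (laterSmaller? r) (range 0 (suc r + k))
      ≡⟨ cong (count (laterSmaller? r)) (range-++ 0 (suc r) k) ⟩
    count (laterSmaller? r) (range 0 (suc r) ++ range (suc r) k)
      ≡⟨ count-++ (laterSmaller? r) (range 0 (suc r)) (range (suc r) k) ⟩
    count (laterSmaller? r) (range 0 (suc r)) + count (laterSmaller? r) (range (suc r) k)
      ≡⟨ cong (_+ count (laterSmaller? r) (range (suc r) k)) (count-none (laterSmaller? r) _ not-later) ⟩
    count (laterSmaller? r) (range (suc r) k) ∎
    where
    open ≡-Reasoning
    not-later : ∀ {t} → t ∈ range 0 (suc r) → ¬ LaterSmaller r t
    not-later t∈ (r<t , _) = <⇒≱ r<t (s≤s⁻¹ (proj₂ (∈-range⁻ t∈)))

  lehmerℕ>0⇒< : ∀ n r → 0 < lehmerℕ n r → r < n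
  lehmerℕ>0⇒< n r pos with count>0⇒∃ (laterSmaller? r) (range 0 n) pos
  ... | t , t∈ , r<t , _ = <-trans r<t (proj₂ (∈-range⁻ t∈))

  lehmerℕ-≥ : ∀ n r → n ≤ r → lehmerℕ n r ≡ 0
  lehmerℕ-≥ n r n≤r =
    count-none (laterSmaller? r) (range 0 n) λ t∈ (r<t , _) → <⇒≱ (<-trans r<t (proj₂ (∈-range⁻ t∈))) n≤r

module _ (f : ℕ → ℕ) (f-injective : Injective _≡_ _≡_ f) where

  ≮⇒> : ∀ {x y} → x ≢ y → ¬ f x < f y → f y < f x
  ≮⇒> x≢y fx≮fy = ≤∧≢⇒< (≮⇒≥ fx≮fy) (x≢y ∘ f-injective ∘ sym)

module _ {a r} {A : Set a} {R : Rel A r} (R-trans : Transitive R) where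

  linked-∷ʳ⁻ : ∀ {k} {xs : Vec A k} {y} → Linked R (xs ∷ʳ y) → Linked R xs × VecAll.All (λ x → R x y) xs
  linked-∷ʳ⁻ {xs = []} _ = [] , []
  linked-∷ʳ⁻ {xs = x ∷ []} (Rxy ∷ [-]) = [-] , Rxy ∷ []
  linked-∷ʳ⁻ {xs = x ∷ x′ ∷ xs} {y} (Rxx′ ∷ rest) with linked-∷ʳ⁻ {xs = x′ ∷ xs} {y} rest
  ... | rest′ , bounds@(Rx′y ∷ _) = Rxx′ ∷ rest′ , R-trans Rxx′ Rx′y ∷ bounds

-- The positions are listed left to right, followed by the bound n; τ lists
-- the indices of the pattern by increasing value (2413 has τ = 2, 0, 3, 1).
record Occurrence {k} (f : ℕ → ℕ) (n : ℕ) (τ : Vec (Fin k) k) : Set where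
  field
    at         : Vec ℕ k
    increasing : Linked _<_ (at ∷ʳ n)
    ascending  : Linked _<_ (Vec.map (f ∘ lookup at) τ)

ValueOrder : ∀ {k} → Vec ℕ k → Vec (Fin k) k → Set
ValueOrder π τ = (∀ r → lookup π (lookup τ r) ≡ suc (toℕ r)) × (∀ p → ∃ λ r → lookup τ r ≡ p)

valueOrder? : ∀ {k} (π : Vec ℕ k) τ → Dec (ValueOrder π τ)
valueOrder? π τ =
  all? (λ r → lookup π (lookup τ r) ≟ suc (toℕ r)) ×-dec all? (λ p → Fin.any? (λ r → lookup τ r Fin.≟ p))

τ2413 τ2431 : Vec (Fin 4) 4
τ2413 = # 2 ∷ # 0 ∷ # 3 ∷ # 1 ∷ []
τ2431 = # 3 ∷ # 0 ∷ # 2 ∷ # 1 ∷ []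

τ32154 : Vec (Fin 5) 5
τ32154 = # 2 ∷ # 1 ∷ # 0 ∷ # 4 ∷ # 3 ∷ []

τ341265 : Vec (Fin 6) 6
τ341265 = # 2 ∷ # 3 ∷ # 0 ∷ # 1 ∷ # 5 ∷ # 4 ∷ []

Patterns : (ℕ → ℕ) → ℕ → Set
Patterns f n = Occurrence f n τ2413 ⊎ Occurrence f n τ2431 ⊎ Occurrence f n τ32154 ⊎ Occurrence f n τ341265

-- Sequences with at least as many inversions as entries

module Inversions (f : ℕ → ℕ) (f-injective : Injective _≡_ _≡_ f) (W : Pred ℕ 0ℓ) where

  below? : ∀ v → Decidable (λ t → f t < f v)
  below? v t = f t <? f v

  inversions : List ℕ → ℕ
  inversions [] = 0
  inversions (x ∷ xs) = count (below? x) xs + inversions xs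

  record Pattern321 : Set where
    field
      a b c : ℕ
      a<b : a < b
      b<c : b < c
      fc<fb : f c < f b
      fb<fa : f b < f a
      Wa : W a
      Wb : W b
      Wc : W c

  record Pattern3412 : Set where
    field
      a b c d : ℕ
      a<b : a < b
      b<c : b < c
      c<d : c < d
      fc<fd : f c < f d
      fd<fa : f d < f a
      fa<fb : f a < f b
      Wa : W a
      Wb : W b
      Wc : W c
      Wd : W d

  Has321⊎3412 : Set
  Has321⊎3412 = Pattern321 ⊎ Pattern3412

  -- Removes the entries below v except the last one. Unless 321 or 3412 occurs, the removed
  -- entries are in no inversion, so removing them and v loses at most one inversion per entry.
  prune : ℕ → List ℕ → List ℕ
  prune v [] = []
  prune v (y ∷ ys) with below? v y | count (below? v) ys
  ... | yes _ | suc _ = prune v ys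
  ... | yes _ | zero  = y ∷ prune v ys
  ... | no _  | _     = y ∷ prune v ys

  prune-⊆ : ∀ v ys → prune v ys ⊆ ys
  prune-⊆ v (y ∷ ys) with below? v y | count (below? v) ys
  ... | yes _ | suc _ = there ∘ prune-⊆ v ys
  ... | yes _ | zero  = ∷⁺ʳ y (prune-⊆ v ys)
  ... | no _  | _     = ∷⁺ʳ y (prune-⊆ v ys)

  prune-all : ∀ {P : Pred ℕ 0ℓ} v ys → All P ys → All P (prune v ys)
  prune-all v ys Pys = All.tabulate (All.lookup Pys ∘ prune-⊆ v ys)

  prune-increasing : ∀ v ys → AllPairs _<_ ys → AllPairs _<_ (prune v ys)
  prune-increasing v [] [] = []
  prune-increasing v (y ∷ ys) (y<ys ∷ ys↗) with below? v y | count (below? v) ys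
  ... | yes _ | suc _ = prune-increasing v ys ys↗
  ... | yes _ | zero  = prune-all v ys y<ys ∷ prune-increasing v ys ys↗
  ... | no _  | _     = prune-all v ys y<ys ∷ prune-increasing v ys ys↗

  prune-id : ∀ v ys → count (below? v) ys ≡ 0 → prune v ys ≡ ys
  prune-id v [] _ = refl
  prune-id v (y ∷ ys) none with below? v y | count (below? v) ys in eq
  prune-id v (y ∷ ys) () | yes _ | _
  ... | no _ | zero = cong (y ∷_) (prune-id v ys eq)
  ... | no _ | suc _ = ⊥-elim (1+n≢0 (trans (sym eq) none))

  prune-length : ∀ v ys → 0 < count (below? v) ys → length (prune v ys) + count (below? v) ys ≡ suc (length ys)
  prune-length v (y ∷ ys) some with below? v y | count (below? v) ys in eq
  ... | yes _ | suc _ = begin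
    length (prune v ys) + suc (count (below? v) ys)  ≡⟨ +-suc _ _ ⟩
    suc (length (prune v ys) + count (below? v) ys)  ≡⟨ cong suc (prune-length v ys (subst (0 <_) (sym eq) z<s)) ⟩
    suc (suc (length ys))                            ∎
    where open ≡-Reasoning
  ... | yes _ | zero = begin
    suc (length (prune v ys)) + suc (count (below? v) ys)
      ≡⟨ cong₂ (λ zs c → suc (length zs) + suc c) (prune-id v ys eq) eq ⟩
    suc (length ys) + 1                                     ≡⟨ +-comm _ 1 ⟩
    suc (suc (length ys))                                   ∎
    where open ≡-Reasoning
  ... | no _ | suc _ = cong suc (prune-length v ys (subst (0 <_) (sym eq) z<s))
  ... | no _ | zero = ⊥-elim (<-irrefl (sym eq) some)

  +-mono-⊎ : ∀ {a b c d} → Has321⊎3412 ⊎ a ≤ b → Has321⊎3412 ⊎ c ≤ d → Has321⊎3412 ⊎ a + c ≤ b + d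
  +-mono-⊎ (inj₁ p) _ = inj₁ p
  +-mono-⊎ (inj₂ _) (inj₁ p) = inj₁ p
  +-mono-⊎ (inj₂ a≤b) (inj₂ c≤d) = inj₂ (+-mono-≤ a≤b c≤d)

  prune-count-below-larger : ∀ {v y} zs → v < y → f v < f y → W v → W y →
    All (y <_) zs → AllPairs _<_ zs → All W zs →
    Has321⊎3412 ⊎ count (below? y) zs ≤ count (below? y) (prune v zs)
  prune-count-below-larger [] _ _ _ _ _ _ _ = inj₂ z≤n
  prune-count-below-larger {v} {y} (z ∷ zs) v<y fv<fy Wv Wy (y<z ∷ y<zs) (z<zs ∷ zs↗) (Wz ∷ Wzs)
    with below? v z | count (below? v) zs in eq
  ... | yes fz<fv | suc _ with below? y z
  ...   | no _ = prune-count-below-larger zs v<y fv<fy Wv Wy y<zs zs↗ Wzs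
  ...   | yes fz<fy with count>0⇒∃ (below? v) zs (subst (0 <_) (sym eq) z<s)
  ...     | s , s∈zs , fs<fv with f z <? f s
  ...       | yes fz<fs = inj₁ (inj₂ record
                { a<b = v<y ; b<c = y<z ; c<d = All.lookup z<zs s∈zs
                ; fc<fd = fz<fs ; fd<fa = fs<fv ; fa<fb = fv<fy
                ; Wa = Wv ; Wb = Wy ; Wc = Wz ; Wd = All.lookup Wzs s∈zs })
  ...       | no fz≮fs = inj₁ (inj₁ record
                { a<b = <-trans v<y y<z ; b<c = All.lookup z<zs s∈zs
                ; fc<fb = ≮⇒> f f-injective (<⇒≢ (All.lookup z<zs s∈zs)) fz≮fs ; fb<fa = fz<fv
                ; Wa = Wv ; Wb = Wz ; Wc = All.lookup Wzs s∈zs })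
  prune-count-below-larger {v} {y} (z ∷ zs) v<y fv<fy Wv Wy (y<z ∷ y<zs) (z<zs ∷ zs↗) (Wz ∷ Wzs) | yes _ | zero =
    Sum.map₂ (count-∷-mono (below? y) z) (prune-count-below-larger zs v<y fv<fy Wv Wy y<zs zs↗ Wzs)
  prune-count-below-larger {v} {y} (z ∷ zs) v<y fv<fy Wv Wy (y<z ∷ y<zs) (z<zs ∷ zs↗) (Wz ∷ Wzs) | no _ | _ =
    Sum.map₂ (count-∷-mono (below? y) z) (prune-count-below-larger zs v<y fv<fy Wv Wy y<zs zs↗ Wzs)

  prune-inversions : ∀ v ys → W v → All (v <_) ys → AllPairs _<_ ys → All W ys →
                     Has321⊎3412 ⊎ inversions ys ≤ inversions (prune v ys)
  prune-inversions v [] _ _ _ _ = inj₂ z≤n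
  prune-inversions v (y ∷ ys) Wv (v<y ∷ v<ys) (y<ys ∷ ys↗) (Wy ∷ Wys) with below? v y | count (below? v) ys in eq
  ... | yes fy<fv | suc _ with count (below? y) ys in eq′
  ...   | zero = prune-inversions v ys Wv v<ys ys↗ Wys
  ...   | suc _ with count>0⇒∃ (below? y) ys (subst (0 <_) (sym eq′) z<s)
  ...     | t , t∈ys , ft<fy = inj₁ (inj₁ record
              { a<b = v<y ; b<c = All.lookup y<ys t∈ys ; fc<fb = ft<fy ; fb<fa = fy<fv
              ; Wa = Wv ; Wb = Wy ; Wc = All.lookup Wys t∈ys })
  prune-inversions v (y ∷ ys) Wv (v<y ∷ v<ys) (y<ys ∷ ys↗) (Wy ∷ Wys) | yes fy<fv | zero =
    +-mono-⊎ (inj₂ (≤-trans (count-mono (below? y) (below? v) ys (λ _ ft<fy → <-trans ft<fy fy<fv))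
                            (≤-trans (≤-reflexive eq) z≤n)))
             (prune-inversions v ys Wv v<ys ys↗ Wys)
  prune-inversions v (y ∷ ys) Wv (v<y ∷ v<ys) (y<ys ∷ ys↗) (Wy ∷ Wys) | no fy≮fv | _ =
    +-mono-⊎ (prune-count-below-larger ys v<y (≮⇒> f f-injective (>⇒≢ v<y) fy≮fv) Wv Wy y<ys ys↗ Wys)
             (prune-inversions v ys Wv v<ys ys↗ Wys)

  inversions≥length⇒321⊎3412 : ∀ S → AllPairs _<_ S → All W S → 0 < length S →
                               length S ≤ inversions S → Has321⊎3412
  inversions≥length⇒321⊎3412 S = go S (<-wellFounded (length S))
    where
    go : ∀ S → Acc _<_ (length S) → AllPairs _<_ S → All W S → 0 < length S →
         length S ≤ inversions S → Has321⊎3412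
    go (v ∷ []) _ _ _ _ ()
    go (v ∷ ys@(_ ∷ _)) (acc shorter) (v<ys ∷ ys↗) (Wv ∷ Wys) _ len≤inv with count (below? v) ys in eq
    ... | zero = go ys (shorter ≤-refl) ys↗ Wys z<s (≤-trans (n≤1+n _) len≤inv)
    ... | suc k with prune-inversions v ys Wv v<ys ys↗ Wys
    ...   | inj₁ p = p
    ...   | inj₂ inv≤ =
      go (prune v ys) (shorter pruned<) (prune-increasing v ys ys↗) (prune-all v ys Wys) pruned>0 pruned≤inv
      where
      L = length (prune v ys)
      pruned-length : L + suc k ≡ suc (length ys)
      pruned-length = subst (λ c → L + c ≡ suc (length ys)) eq (prune-length v ys (subst (0 <_) (sym eq) z<s))
      pruned< : L < suc (length ys)
      pruned< = subst (L <_) pruned-length (m<m+n L z<s)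
      pruned>0 : 0 < L
      pruned>0 = +-cancelʳ-≤ (suc k) 1 L (begin
        suc (suc k)       ≤⟨ s≤s (subst (_≤ length ys) eq (count≤length (below? v) ys)) ⟩
        suc (length ys)   ≡⟨ pruned-length ⟨
        L + suc k         ∎)
        where open ≤-Reasoning
      pruned≤inv : L ≤ inversions (prune v ys)
      pruned≤inv = +-cancelʳ-≤ (suc k) L (inversions (prune v ys)) (begin
        L + suc k                          ≡⟨ pruned-length ⟩
        suc (length ys)                    ≤⟨ len≤inv ⟩
        suc k + inversions ys              ≤⟨ +-monoʳ-≤ (suc k) inv≤ ⟩
        suc k + inversions (prune v ys)    ≡⟨ +-comm (suc k) _ ⟩
        inversions (prune v ys) + suc k    ∎)
        where open ≤-Reasoning

-- The window argument

module Window (f : ℕ → ℕ) (f-injective : Injective _≡_ _≡_ f) (n I m q : ℕ)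
              (J<n : I + m < n) (q≤ℓJ : q ≤ lehmerℕ f n (I + m)) where

  J : ℕ
  J = I + m

  ℓ : ℕ → ℕ
  ℓ = lehmerℕ f n

  tail : List ℕ
  tail = range (suc J) (n ∸ suc J)

  J+tail≡n : suc J + (n ∸ suc J) ≡ n
  J+tail≡n = m+[n∸m]≡n J<n

  ∈-tail⁻ : ∀ {t} → t ∈ tail → J < t × t < n
  ∈-tail⁻ {t} t∈ with ∈-range⁻ t∈
  ... | J<t , t<n = J<t , subst (t <_) J+tail≡n t<n

  ℓ-split : ∀ r k → suc r + k ≡ J →
            ℓ r ≡ count (laterSmaller? f r) (range (suc r) k) + count (laterSmaller? f r) (J ∷ tail)
  ℓ-split r k r+k≡J = begin
    ℓ r
      ≡⟨ lehmerℕ-suffix f n r (k + suc t) r+k+t≡n ⟩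
    count (laterSmaller? f r) (range (suc r) (k + suc t))
      ≡⟨ cong (count (laterSmaller? f r)) (range-++ (suc r) k (suc t)) ⟩
    count (laterSmaller? f r) (range (suc r) k ++ range (suc r + k) (suc t))
      ≡⟨ count-++ (laterSmaller? f r) (range (suc r) k) _ ⟩
    count (laterSmaller? f r) (range (suc r) k) + count (laterSmaller? f r) (range (suc r + k) (suc t))
      ≡⟨ cong (λ a → count (laterSmaller? f r) (range (suc r) k) + count (laterSmaller? f r) (range a (suc t))) r+k≡J ⟩
    count (laterSmaller? f r) (range (suc r) k) + count (laterSmaller? f r) (J ∷ tail) ∎
    where
    open ≡-Reasoning
    t = n ∸ suc J
    r+k+t≡n : suc r + (k + suc t) ≡ n
    r+k+t≡n = begin
      suc r + (k + suc t)  ≡⟨ +-assoc (suc r) k _ ⟨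
      suc r + k + suc t    ≡⟨ cong (_+ suc t) r+k≡J ⟩
      J + suc t            ≡⟨ +-suc J t ⟩
      suc J + t            ≡⟨ J+tail≡n ⟩
      n                    ∎

  ℓJ≡count-tail : ℓ J ≡ count (laterSmaller? f J) tail
  ℓJ≡count-tail = lehmerℕ-suffix f n J (n ∸ suc J) J+tail≡n

  Underneath : ℕ → Set
  Underneath r = f r < f J × (∀ {t} → t ∈ tail → f t < f J → f r < f t)

  -- Positions are 0-based: Bound r is what the solo climb of c_b through row r + 1 of
  -- P_bott forces, with J + 1 the row of c_b and q its column.
  Bound : ℕ → Set
  Bound r = suc r + ℓ r < J + q

  -- The hypotheses give ℓ r ≥ (J - r - 1) + q, more than Bound r allows.
  all-below-violates-bound : ∀ r k → suc r + k ≡ J → Bound r →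
    (∀ {t} → t ∈ range (suc r) k → f t < f r) → (∀ {t} → t ∈ tail → f t < f J → f t < f r) → ⊥
  all-below-violates-bound r k r+k≡J bound between tail-low = <-irrefl refl (begin-strict
    suc r + (k + q)    ≤⟨ +-monoʳ-≤ (suc r) (subst (k + q ≤_) (sym (ℓ-split r k r+k≡J)) (+-mono-≤ k≤ q≤)) ⟩
    suc r + ℓ r        <⟨ bound ⟩
    J + q              ≡⟨ cong (_+ q) r+k≡J ⟨
    suc r + k + q      ≡⟨ +-assoc (suc r) k q ⟩
    suc r + (k + q)    ∎)
    where
    open ≤-Reasoning
    r<J = m+n≤o⇒m≤o (suc r) (≤-reflexive r+k≡J)
    k≤ : k ≤ count (laterSmaller? f r) (range (suc r) k)
    k≤ = ≤-reflexive (trans (sym (length-range (suc r) k))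
           (sym (count-all (laterSmaller? f r) _ λ t∈ → proj₁ (∈-range⁻ t∈) , between t∈)))
    q≤ : q ≤ count (laterSmaller? f r) (J ∷ tail)
    q≤ = begin
      q                                         ≤⟨ q≤ℓJ ⟩
      ℓ J                                       ≡⟨ ℓJ≡count-tail ⟩
      count (laterSmaller? f J) tail            ≤⟨ count-mono (laterSmaller? f J) (laterSmaller? f r) tail
                                                     (λ t∈ (J<t , ft<fJ) → <-trans r<J J<t , tail-low t∈ ft<fJ) ⟩
      count (laterSmaller? f r) tail            ≤⟨ count-≤-∷ (laterSmaller? f r) J tail ⟩
      count (laterSmaller? f r) (J ∷ tail)      ∎

  underneath-step : ∀ r k → suc r + k ≡ J → Bound r → (∀ {t} → t ∈ range (suc r) k → Underneath t) →
                    Patterns f n ⊎ Underneath r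
  underneath-step r k r+k≡J bound later with r<J ← m+n≤o⇒m≤o (suc r) (≤-reflexive r+k≡J) | f r <? f J
  ... | no fr≮fJ = ⊥-elim (all-below-violates-bound r k r+k≡J bound
                      (λ t∈ → <-trans (proj₁ (later t∈)) fJ<fr) (λ _ ft<fJ → <-trans ft<fJ fJ<fr))
    where fJ<fr = ≮⇒> f f-injective (<⇒≢ r<J) fr≮fJ
  ... | yes fr<fJ with any? (λ t → (f t <? f J) ×-dec (f t <? f r)) tail
  ...   | no no-low = inj₂ (fr<fJ , λ t∈ ft<fJ → ≮⇒> f f-injective (>⇒≢ (<-trans r<J (proj₁ (∈-tail⁻ t∈))))
                                                   (λ ft<fr → no-low (lose t∈ (ft<fJ , ft<fr))))
  ...   | yes low with find low
  ...     | u , u∈ , fu<fJ , fu<fr with any? (λ t → (f r <? f t) ×-dec (f t <? f J)) tail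
  ...       | no no-mid = ⊥-elim (all-below-violates-bound r k r+k≡J bound
                            (λ t∈ → <-trans (proj₂ (later t∈) u∈ fu<fJ) fu<fr)
                            (λ t∈ ft<fJ → ≮⇒> f f-injective (<⇒≢ (<-trans r<J (proj₁ (∈-tail⁻ t∈))))
                                             (λ fr<ft → no-mid (lose t∈ (fr<ft , ft<fJ)))))
  ...       | yes mid with find mid
  ...         | w , w∈ , fr<fw , fw<fJ with <-cmp u w
  ...           | tri< u<w _ _ = inj₁ (inj₁ record
                    { at = r ∷ J ∷ u ∷ w ∷ []
                    ; increasing = r<J ∷ proj₁ (∈-tail⁻ u∈) ∷ u<w ∷ proj₂ (∈-tail⁻ w∈) ∷ [-]
                    ; ascending = fu<fr ∷ fr<fw ∷ fw<fJ ∷ [-] })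
  ...           | tri≈ _ refl _ = ⊥-elim (<-asym fu<fr fr<fw)
  ...           | tri> _ _ w<u = inj₁ (inj₂ (inj₁ record
                    { at = r ∷ J ∷ w ∷ u ∷ []
                    ; increasing = r<J ∷ proj₁ (∈-tail⁻ w∈) ∷ w<u ∷ proj₂ (∈-tail⁻ u∈) ∷ [-]
                    ; ascending = fu<fr ∷ fr<fw ∷ fw<fJ ∷ [-] }))

  all-underneath : ∀ a k → a + k ≡ J → (∀ {r} → a ≤ r → r < J → Bound r) →
                   Patterns f n ⊎ (∀ {t} → t ∈ range a k → Underneath t)
  all-underneath a zero _ _ = inj₂ λ ()
  all-underneath a (suc k) a+k≡J bounds = prepend (all-underneath (suc a) k a+1+k≡J (λ a<r → bounds (<⇒≤ a<r)))
    where
    a+1+k≡J = trans (sym (+-suc a k)) a+k≡J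
    prepend : Patterns f n ⊎ (∀ {t} → t ∈ range (suc a) k → Underneath t) →
              Patterns f n ⊎ (∀ {t} → t ∈ range a (suc k) → Underneath t)
    prepend (inj₁ p) = inj₁ p
    prepend (inj₂ later)
      with underneath-step a k a+1+k≡J (bounds ≤-refl (m+n≤o⇒m≤o (suc a) (≤-reflexive a+1+k≡J))) later
    ... | inj₁ p = inj₁ p
    ... | inj₂ under-a = inj₂ λ { (here refl) → under-a ; (there t∈) → later t∈ }

  open Inversions f f-injective (_∈ range I m)

  sum-ℓ≡inversions : ∀ a k → a + k ≡ J → (∀ {t} → t ∈ range a k → Underneath t) →
                     sum (map ℓ (range a k)) ≡ inversions (range a k)
  sum-ℓ≡inversions a zero _ _ = refl
  sum-ℓ≡inversions a (suc k) a+k≡J under =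
    cong₂ _+_ ℓa≡ (sum-ℓ≡inversions (suc a) k a+1+k≡J (under ∘ there))
    where
    a+1+k≡J = trans (sym (+-suc a k)) a+k≡J
    under-a = under (here refl)
    not-after : ∀ {t} → t ∈ J ∷ tail → ¬ LaterSmaller f a t
    not-after (here refl) (_ , fJ<fa) = <-asym fJ<fa (proj₁ under-a)
    not-after (there t∈) (_ , ft<fa) = <-asym ft<fa (proj₂ under-a t∈ (<-trans ft<fa (proj₁ under-a)))
    ℓa≡ : ℓ a ≡ count (below? a) (range (suc a) k)
    ℓa≡ = begin
      ℓ a                                                       ≡⟨ ℓ-split a k a+1+k≡J ⟩
      count (laterSmaller? f a) (range (suc a) k) + count (laterSmaller? f a) (J ∷ tail)
        ≡⟨ cong₂ _+_ (count-cong (laterSmaller? f a) (below? a) (range (suc a) k)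
                                 (λ _ → proj₂) (λ t∈ ft<fa → proj₁ (∈-range⁻ t∈) , ft<fa))
                     (count-none (laterSmaller? f a) (J ∷ tail) not-after) ⟩
      count (below? a) (range (suc a) k) + 0                    ≡⟨ +-identityʳ _ ⟩
      count (below? a) (range (suc a) k)                        ∎
      where open ≡-Reasoning

  small-tail-entry : 0 < q → ∃ λ t → t ∈ tail × LaterSmaller f J t
  small-tail-entry q>0 = count>0⇒∃ (laterSmaller? f J) tail (subst (0 <_) ℓJ≡count-tail (≤-trans q>0 q≤ℓJ))

  window-patterns : 0 < q → 0 < m → (∀ {r} → I ≤ r → r < J → Bound r) → m ≤ sum (map ℓ (range I m)) →
                    Patterns f n
  window-patterns q>0 m>0 bounds m≤sum with all-underneath I m refl bounds | small-tail-entry q>0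
  ... | inj₁ p | _ = p
  ... | inj₂ under | t₀ , t₀∈ , J<t₀ , ft₀<fJ
    with inversions≥length⇒321⊎3412 (range I m) (range-increasing I m) (All.tabulate id)
           (subst (0 <_) (sym (length-range I m)) m>0)
           (subst₂ _≤_ (sym (length-range I m)) (sum-ℓ≡inversions I m refl under) m≤sum)
  ...   | inj₁ p = inj₂ (inj₂ (inj₁ record
            { at = a ∷ b ∷ c ∷ J ∷ t₀ ∷ []
            ; increasing = a<b ∷ b<c ∷ proj₂ (∈-range⁻ Wc) ∷ J<t₀ ∷ proj₂ (∈-tail⁻ t₀∈) ∷ [-]
            ; ascending = fc<fb ∷ fb<fa ∷ proj₂ (under Wa) t₀∈ ft₀<fJ ∷ ft₀<fJ ∷ [-] }))
    where open Pattern321 p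
  ...   | inj₂ p = inj₂ (inj₂ (inj₂ record
            { at = a ∷ b ∷ c ∷ d ∷ J ∷ t₀ ∷ []
            ; increasing = a<b ∷ b<c ∷ c<d ∷ proj₂ (∈-range⁻ Wd) ∷ J<t₀ ∷ proj₂ (∈-tail⁻ t₀∈) ∷ [-]
            ; ascending = fc<fd ∷ fd<fa ∷ fa<fb ∷ proj₂ (under Wb) t₀∈ ft₀<fJ ∷ ft₀<fJ ∷ [-] }))
    where open Pattern3412 p

tabulate-toℕ : ∀ n → tabulate {n = n} toℕ ≡ range 0 n
tabulate-toℕ zero = refl
tabulate-toℕ (suc n) = cong (0 ∷_) (begin
  tabulate (suc ∘ toℕ)    ≡⟨ map-tabulate toℕ suc ⟨
  map suc (tabulate toℕ)  ≡⟨ cong (map suc) (tabulate-toℕ n) ⟩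
  map suc (range 0 n)     ≡⟨ map-suc-range 0 n ⟩
  range 1 n               ∎)
  where open ≡-Reasoning

module _ {n} (σ : Permutation′ n) where

  σ-injective : ∀ {i j} → σ ⟨$⟩ʳ i ≡ σ ⟨$⟩ʳ j → i ≡ j
  σ-injective {i} {j} eq = trans (sym (inverseˡ σ)) (trans (cong (σ ⟨$⟩ˡ_) eq) (inverseˡ σ))

  extend : ℕ → ℕ
  extend k with k <? n
  ... | yes k<n = toℕ (σ ⟨$⟩ʳ fromℕ< k<n)
  ... | no _ = k

  extend-toℕ : ∀ i → extend (toℕ i) ≡ toℕ (σ ⟨$⟩ʳ i)
  extend-toℕ i with toℕ i <? n
  ... | yes i<n = cong (λ j → toℕ (σ ⟨$⟩ʳ j)) (fromℕ<-toℕ i i<n)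
  ... | no i≮n = ⊥-elim (i≮n (toℕ<n i))

  extend-injective : Injective _≡_ _≡_ extend
  extend-injective {a} {b} eq with a <? n | b <? n
  ... | yes a<n | yes b<n = begin
    a                   ≡⟨ toℕ-fromℕ< a<n ⟨
    toℕ (fromℕ< a<n)    ≡⟨ cong toℕ (σ-injective (toℕ-injective eq)) ⟩
    toℕ (fromℕ< b<n)    ≡⟨ toℕ-fromℕ< b<n ⟩
    b                   ∎
    where open ≡-Reasoning
  ... | yes a<n | no b≮n = ⊥-elim (b≮n (subst (_< n) eq (toℕ<n _)))
  ... | no a≮n  | yes b<n = ⊥-elim (a≮n (subst (_< n) (sym eq) (toℕ<n _)))
  ... | no _    | no _   = eq

  code≡lehmer : ∀ k (k<n : k < n) → code σ (suc k) ≡ lehmer σ (fromℕ< k<n)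
  code≡lehmer k k<n with k <? n
  ... | yes _ = refl
  ... | no k≮n = ⊥-elim (k≮n k<n)

  lehmer≡lehmerℕ : ∀ k (k<n : k < n) → lehmer σ (fromℕ< k<n) ≡ lehmerℕ extend n k
  lehmer≡lehmerℕ k k<n = begin
    lehmer σ i
      ≡⟨ length-filter≡count _ (allFin n) ⟩
    count (λ j → (i Fin.<? j) ×-dec ((σ ⟨$⟩ʳ j) Fin.<? (σ ⟨$⟩ʳ i))) (allFin n)
      ≡⟨ count-cong _ _ (allFin n) (λ _ → to) (λ _ → from) ⟩
    count (laterSmaller? extend k ∘ toℕ) (allFin n)
      ≡⟨ count-map (laterSmaller? extend k) toℕ (allFin n) ⟨
    count (laterSmaller? extend k) (map toℕ (allFin n))
      ≡⟨ cong (count (laterSmaller? extend k)) (trans (map-tabulate id toℕ) (tabulate-toℕ n)) ⟩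
    lehmerℕ extend n k ∎
    where
    open ≡-Reasoning
    i = fromℕ< k<n
    ti : toℕ i ≡ k
    ti = toℕ-fromℕ< k<n
    fi : extend k ≡ toℕ (σ ⟨$⟩ʳ i)
    fi = trans (cong extend (sym ti)) (extend-toℕ i)
    to : ∀ {j} → i Fin.< j × (σ ⟨$⟩ʳ j) Fin.< (σ ⟨$⟩ʳ i) → LaterSmaller extend k (toℕ j)
    to {j} (i<j , σj<σi) = subst (_< toℕ j) ti i<j , subst₂ _<_ (sym (extend-toℕ j)) (sym fi) σj<σi
    from : ∀ {j} → LaterSmaller extend k (toℕ j) → i Fin.< j × (σ ⟨$⟩ʳ j) Fin.< (σ ⟨$⟩ʳ i)
    from {j} (k<j , fj<fk) = subst (_< toℕ j) (sym ti) k<j , subst₂ _<_ (extend-toℕ j) fi fj<fk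

  code-suc-≥ : ∀ k → n ≤ k → code σ (suc k) ≡ 0
  code-suc-≥ k n≤k with k <? n
  ... | yes k<n = ⊥-elim (<-irrefl refl (≤-trans k<n n≤k))
  ... | no _ = refl

  code-suc : ∀ k → code σ (suc k) ≡ lehmerℕ extend n k
  code-suc k = by-cases (<-≤-connex k n)
    where
    by-cases : k < n ⊎ n ≤ k → code σ (suc k) ≡ lehmerℕ extend n k
    by-cases (inj₁ k<n) = trans (code≡lehmer k k<n) (lehmer≡lehmerℕ k k<n)
    by-cases (inj₂ n≤k) = trans (code-suc-≥ k n≤k) (sym (lehmerℕ-≥ extend n k n≤k))

  occurrence⇒contains : ∀ {k} (π : Vec ℕ k) τ {order : True (valueOrder? π τ)} →
                        Occurrence extend n τ → Contains σ π
  occurrence⇒contains {k} π τ {order} o = h , h-mono , λ p q → mk⇔ (reflect p q) (preserve p q)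
    where
    rank = proj₁ (toWitness order)
    onto = proj₂ (toWitness order)
    open Occurrence o
    positions = linked-∷ʳ⁻ <-trans increasing
    h : Fin k → Fin n
    h p = fromℕ< (VecAll.lookup⁺ (proj₂ positions) p)
    toℕ-h : ∀ p → toℕ (h p) ≡ lookup at p
    toℕ-h p = toℕ-fromℕ< (VecAll.lookup⁺ (proj₂ positions) p)
    h-mono : ∀ p q → p Fin.< q → h p Fin.< h q
    h-mono p q p<q = subst₂ _<_ (sym (toℕ-h p)) (sym (toℕ-h q)) (lookup⁺ <-trans (proj₁ positions) p<q)
    value : ∀ p → toℕ (σ ⟨$⟩ʳ h p) ≡ extend (lookup at p)
    value p = trans (sym (extend-toℕ (h p))) (cong extend (toℕ-h p))
    ascend : ∀ {r s} → r Fin.< s → σ ⟨$⟩ʳ h (lookup τ r) Fin.< σ ⟨$⟩ʳ h (lookup τ s)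
    ascend {r} {s} r<s = subst₂ _<_ (trans (lookup-map r _ τ) (sym (value _))) (trans (lookup-map s _ τ) (sym (value _)))
                           (lookup⁺ <-trans ascending r<s)
    preserve : ∀ p q → lookup π p < lookup π q → σ ⟨$⟩ʳ h p Fin.< σ ⟨$⟩ʳ h q
    preserve p q πp<πq with onto p | onto q
    ... | r , refl | s , refl = ascend (≤-pred (subst₂ _<_ (rank r) (rank s) πp<πq))
    reflect : ∀ p q → σ ⟨$⟩ʳ h p Fin.< σ ⟨$⟩ʳ h q → lookup π p < lookup π q
    reflect p q σp<σq with onto p | onto q
    ... | r , refl | s , refl with <-cmp (toℕ r) (toℕ s)
    ... | tri< r<s _ _ = subst₂ _<_ (sym (rank r)) (sym (rank s)) (s≤s r<s)
    ... | tri≈ _ r≡s _ = ⊥-elim (<-irrefl (cong (λ x → toℕ (σ ⟨$⟩ʳ h (lookup τ x))) (toℕ-injective r≡s))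
                                          σp<σq)
    ... | tri> _ _ s<r = ⊥-elim (<-asym σp<σq (ascend s<r))

  contains-patterns : Patterns extend n →
    Contains σ (2 ∷ 4 ∷ 1 ∷ 3 ∷ []) ⊎ Contains σ (2 ∷ 4 ∷ 3 ∷ 1 ∷ [])
    ⊎ Contains σ (3 ∷ 2 ∷ 1 ∷ 5 ∷ 4 ∷ []) ⊎ Contains σ (3 ∷ 4 ∷ 1 ∷ 2 ∷ 6 ∷ 5 ∷ [])
  contains-patterns (inj₁ o) = inj₁ (occurrence⇒contains (2 ∷ 4 ∷ 1 ∷ 3 ∷ []) τ2413 o)
  contains-patterns (inj₂ (inj₁ o)) = inj₂ (inj₁ (occurrence⇒contains (2 ∷ 4 ∷ 3 ∷ 1 ∷ []) τ2431 o))
  contains-patterns (inj₂ (inj₂ (inj₁ o))) =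
    inj₂ (inj₂ (inj₁ (occurrence⇒contains (3 ∷ 2 ∷ 1 ∷ 5 ∷ 4 ∷ []) τ32154 o)))
  contains-patterns (inj₂ (inj₂ (inj₂ o))) =
    inj₂ (inj₂ (inj₂ (occurrence⇒contains (3 ∷ 4 ∷ 1 ∷ 2 ∷ 6 ∷ 5 ∷ []) τ341265 o)))

  code-window-patterns : ∀ {i j q} → 0 < i → i < j → 0 < q → q ≤ code σ j →
    (∀ {r} → i ≤ r → r < j → suc r + code σ r < j + q) →
    j ≤ i + sum (map (code σ) (range i (j ∸ i))) → Patterns extend n
  code-window-patterns {suc I} {j} {q} _ i<j q>0 q≤code bounds j≤
    with d , refl ← m≤n⇒∃[o]m+o≡n (<⇒≤ i<j) =
    Window.window-patterns extend extend-injective n I d q J<n q≤ℓJ q>0 d>0 window-bounds d≤sum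
    where
    ℓ = lehmerℕ extend n
    q≤ℓJ : q ≤ ℓ (I + d)
    q≤ℓJ = subst (q ≤_) (code-suc (I + d)) q≤code
    J<n : I + d < n
    J<n = lehmerℕ>0⇒< extend n (I + d) (≤-trans q>0 q≤ℓJ)
    d>0 : 0 < d
    d>0 = +-cancelˡ-≤ (suc I) 1 d (subst (_≤ suc I + d) (+-comm 1 (suc I)) i<j)
    window-bounds : ∀ {r} → I ≤ r → r < I + d → suc r + ℓ r < I + d + q
    window-bounds {r} I≤r r<J =
      s<s⁻¹ (subst (λ c → suc (suc r) + c < suc (I + d) + q) (code-suc r) (bounds (s≤s I≤r) (s≤s r<J)))
    d≤sum : d ≤ sum (map ℓ (range I d))
    d≤sum = +-cancelˡ-≤ (suc I) d _ (begin
      suc I + d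
        ≤⟨ j≤ ⟩
      suc I + sum (map (code σ) (range (suc I) (suc I + d ∸ suc I)))
        ≡⟨ cong (λ k → suc I + sum (map (code σ) (range (suc I) k))) (m+n∸m≡n (suc I) d) ⟩
      suc I + sum (map (code σ) (range (suc I) d))
        ≡⟨ cong (λ xs → suc I + sum (map (code σ) xs)) (map-suc-range I d) ⟨
      suc I + sum (map (code σ) (map suc (range I d)))
        ≡⟨ cong (λ xs → suc I + sum xs) (map-∘ (range I d)) ⟨
      suc I + sum (map (code σ ∘ suc) (range I d))
        ≡⟨ cong (λ xs → suc I + sum xs) (map-cong code-suc (range I d)) ⟩
      suc I + sum (map ℓ (range I d))                                  ∎)
      where open ≤-Reasoning

-- Binary indexed forests

leaves>0 : ∀ t → 0 < leaves t
leaves>0 leaf = z<s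
leaves>0 (node l r) = ≤-trans (leaves>0 l) (m≤m+n _ _)

offsets : Tree → List ℕ
offsets t = map offsetP (allPaths t)

offsets-node : ∀ l r → offsets (node l r) ≡ 0 ∷ offsets l ++ map (leaves l +_) (offsets r)
offsets-node l r = cong (0 ∷_) (begin
  map offsetP (map goL (allPaths l) ++ map goR (allPaths r))
    ≡⟨ map-++ offsetP (map goL (allPaths l)) _ ⟩
  map offsetP (map goL (allPaths l)) ++ map offsetP (map goR (allPaths r))
    ≡⟨ cong₂ _++_ (map-∘ (allPaths l)) (map-∘ (allPaths r)) ⟨
  offsets l ++ map ((leaves l +_) ∘ offsetP) (allPaths r)
    ≡⟨ cong (offsets l ++_) (map-∘ (allPaths r)) ⟩
  offsets l ++ map (leaves l +_) (offsets r)                               ∎)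
  where open ≡-Reasoning

length-offsets : ∀ t → suc (length (offsets t)) ≡ leaves t
length-offsets t = trans (cong suc (length-map offsetP (allPaths t))) (suc-length t)
  where
  suc-length : ∀ t → suc (length (allPaths t)) ≡ leaves t
  suc-length leaf = refl
  suc-length (node l r) = begin
    suc (suc (length (map goL (allPaths l) ++ map goR (allPaths r))))
      ≡⟨ cong (suc ∘ suc) (trans (length-++ (map goL (allPaths l)))
                                 (cong₂ _+_ (length-map goL (allPaths l)) (length-map goR (allPaths r)))) ⟩
    suc (suc (length (allPaths l) + length (allPaths r)))  ≡⟨ cong suc (+-suc _ _) ⟨
    suc (length (allPaths l)) + suc (length (allPaths r))  ≡⟨ cong₂ _+_ (suc-length l) (suc-length r) ⟩
    leaves l + leaves r                                    ∎
    where open ≡-Reasoning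

offsetP<leaves : ∀ {t} (p : Path t) → offsetP p < leaves t
offsetP<leaves (here {l}) = ≤-trans (leaves>0 l) (m≤m+n _ _)
offsetP<leaves (goL p) = ≤-trans (offsetP<leaves p) (m≤m+n _ _)
offsetP<leaves (goR {l} p) = +-monoʳ-< (leaves l) (offsetP<leaves p)

∈-offsets⁻ : ∀ {t x} → x ∈ offsets t → x < leaves t
∈-offsets⁻ {t} x∈ with ∈-map⁻ offsetP x∈
... | p , _ , refl = offsetP<leaves p

module _ {p} {P : Pred ℕ p} (P? : Decidable P) (l r : Tree) where

  count-offsets-left : count P? (offsets l) ≤ count P? (offsets (node l r))
  count-offsets-left = begin
    count P? (offsets l)                                              ≤⟨ count-≤-++ˡ P? (offsets l) _ ⟩
    count P? (offsets l ++ map (leaves l +_) (offsets r))             ≤⟨ count-≤-∷ P? 0 _ ⟩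
    count P? (0 ∷ offsets l ++ map (leaves l +_) (offsets r))         ≡⟨ cong (count P?) (offsets-node l r) ⟨
    count P? (offsets (node l r))                                     ∎
    where open ≤-Reasoning

  count-offsets-right : count P? (map (leaves l +_) (offsets r)) ≤ count P? (offsets (node l r))
  count-offsets-right = begin
    count P? (map (leaves l +_) (offsets r))                          ≤⟨ count-≤-++ʳ P? (offsets l) _ ⟩
    count P? (offsets l ++ map (leaves l +_) (offsets r))             ≤⟨ count-≤-∷ P? 0 _ ⟩
    count P? (0 ∷ offsets l ++ map (leaves l +_) (offsets r))         ≡⟨ cong (count P?) (offsets-node l r) ⟨
    count P? (offsets (node l r))                                     ∎
    where open ≤-Reasoning

record Populated (x y : ℕ) (xs : List ℕ) : Set where
  constructor populated
  field
    ordered : x < y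
    dense   : y ≤ x + count (between? x y) xs

populated-⊆ : ∀ {x y xs} ys → Populated x y xs → count (between? x y) xs ≤ count (between? x y) ys →
              Populated x y ys
populated-⊆ {x} _ (populated x<y y≤) xs≤ys = populated x<y (≤-trans y≤ (+-monoʳ-≤ x xs≤ys))

populated-shift : ∀ K {x y xs} → Populated x y xs → Populated (K + x) (K + y) (map (K +_) xs)
populated-shift K {x} {y} {xs} (populated x<y y≤) = populated (+-monoʳ-< K x<y) (begin
  K + y                                                           ≤⟨ +-monoʳ-≤ K y≤ ⟩
  K + (x + count (between? x y) xs)                               ≡⟨ +-assoc K x _ ⟨
  K + x + count (between? x y) xs                                 ≡⟨ cong (K + x +_) (count-between-shift K x y xs) ⟨
  K + x + count (between? (K + x) (K + y)) (map (K +_) xs)        ∎)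
  where open ≤-Reasoning

right-child-offsets : ∀ {t} {a b : Path t} → RightChildP a b → Populated (offsetP a) (offsetP b) (offsets t)
right-child-offsets (rc-here {l} {rl} {rr}) = populated (subst (0 <_) (sym (+-identityʳ _)) (leaves>0 l)) (begin
  leaves l + 0                                             ≡⟨ +-identityʳ _ ⟩
  leaves l                                                 ≡⟨ length-offsets l ⟨
  suc (length (offsets l))                                 ≡⟨ cong suc (count-all left-window (offsets l) inside) ⟨
  suc (count left-window (offsets l))
    ≡⟨ count-accept left-window (z≤n , subst (0 <_) (sym (+-identityʳ _)) (leaves>0 l)) ⟨
  count left-window (0 ∷ offsets l)
    ≤⟨ count-∷-mono left-window 0 (count-≤-++ˡ left-window (offsets l) _) ⟩
  count left-window (0 ∷ offsets l ++ _)                   ≡⟨ cong (count left-window) (offsets-node l (node rl rr)) ⟨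
  count left-window (offsets (node l (node rl rr)))        ∎)
  where
  open ≤-Reasoning
  left-window = between? 0 (leaves l + 0)
  inside : ∀ {x} → x ∈ offsets l → 0 ≤ x × x < leaves l + 0
  inside x∈ = z≤n , subst (_ <_) (sym (+-identityʳ _)) (∈-offsets⁻ x∈)
right-child-offsets (rc-L {l} {r} {a} {b} a-b) =
  populated-⊆ (offsets (node l r)) (right-child-offsets a-b) (count-offsets-left (between? (offsetP a) (offsetP b)) l r)
right-child-offsets (rc-R {l} {r} {a} {b} a-b) =
  populated-⊆ (offsets (node l r)) (populated-shift (leaves l) (right-child-offsets a-b))
    (count-offsets-right (between? (leaves l + offsetP a) (leaves l + offsetP b)) l r)

ρs : ℕ → Forest → List ℕ
ρs b F = map ρV (allV b F)

ρs-cons : ∀ b g t F → ρs b ((g , t) ∷ F) ≡ map (b + suc g +_) (offsets t) ++ ρs (b + g + leaves t + 1) F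
ρs-cons b g t F = trans (map-++ ρV (map inHere (allPaths t)) _)
  (cong₂ _++_ (trans (sym (map-∘ (allPaths t))) (map-∘ (allPaths t))) (sym (map-∘ (allV (b + g + leaves t + 1) F))))

right-child-rows : ∀ {b F} {v w : Vertex b F} → RightChildV v w → Populated (ρV v) (ρV w) (ρs b F)
right-child-rows (rcv-here {b} {g} {t} {F} {p} {q} p-q) =
  populated-⊆ (ρs b ((g , t) ∷ F)) (populated-shift (b + suc g) (right-child-offsets p-q))
    (subst (count window (map (b + suc g +_) (offsets t)) ≤_) (cong (count window) (sym (ρs-cons b g t F)))
      (count-≤-++ˡ window (map (b + suc g +_) (offsets t)) (ρs (b + g + leaves t + 1) F)))
  where window = between? (b + suc g + offsetP p) (b + suc g + offsetP q)
right-child-rows (rcv-later {b} {g} {t} {F} {v} {w} v-w) =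
  populated-⊆ (ρs b ((g , t) ∷ F)) (right-child-rows v-w)
    (subst (count window (ρs (b + g + leaves t + 1) F) ≤_) (cong (count window) (sym (ρs-cons b g t F)))
      (count-≤-++ʳ window (map (b + suc g +_) (offsets t)) (ρs (b + g + leaves t + 1) F)))
  where window = between? (ρV v) (ρV w)

ρV>0 : ∀ {b F} (v : Vertex b F) → 0 < ρV v
ρV>0 {b} (inHere {g = g} p) = <-≤-trans z<s (≤-trans (m≤n+m (suc g) b) (m≤m+n (b + suc g) (offsetP p)))
ρV>0 (inLater v) = ρV>0 v

codeF≡count-ρs : ∀ F r → codeF F r ≡ count (_≟ r) (ρs 0 F)
codeF≡count-ρs F r = trans (length-filter≡count _ (allV 0 F)) (sym (count-map (_≟ r) ρV (allV 0 F)))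

codeF-zero : ∀ F → codeF F 0 ≡ 0
codeF-zero F = trans (codeF≡count-ρs F 0) (count-none (_≟ 0) (ρs 0 F) λ x∈ x≡0 → positive x∈ x≡0)
  where
  positive : ∀ {x} → x ∈ ρs 0 F → x ≢ 0
  positive x∈ with ∈-map⁻ ρV x∈
  ... | v , _ , refl = >⇒≢ (ρV>0 v)

right-child-code : ∀ {F} {a b : IN F} → RightChildV a b →
                   ρ a < ρ b × ρ b ≤ ρ a + sum (map (codeF F) (range (ρ a) (ρ b ∸ ρ a)))
right-child-code {F} {a} {b} a-b with right-child-rows a-b
... | populated a<b b≤ = a<b , ≤-trans b≤ (+-monoʳ-≤ (ρ a) (begin
  count (between? (ρ a) (ρ b)) (ρs 0 F)
    ≡⟨ cong (λ x → count (between? (ρ a) x) (ρs 0 F)) (m+[n∸m]≡n (<⇒≤ a<b)) ⟨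
  count (between? (ρ a) (ρ a + (ρ b ∸ ρ a))) (ρs 0 F)
    ≤⟨ count-between≤sum (ρs 0 F) (ρ a) (ρ b ∸ ρ a) ⟩
  sum (map (λ r → count (_≟ r) (ρs 0 F)) (range (ρ a) (ρ b ∸ ρ a)))
    ≡⟨ cong sum (map-cong (codeF≡count-ρs F) (range (ρ a) (ρ b ∸ ρ a))) ⟨
  sum (map (codeF F) (range (ρ a) (ρ b ∸ ρ a)))                    ∎))
  where open ≤-Reasoning

codeF≗code : ∀ {n} (σ : Permutation′ n) F → (∀ i → codeF F (suc i) ≡ code σ (suc i)) →
             ∀ r → codeF F r ≡ code σ r
codeF≗code σ F codes zero = codeF-zero F
codeF≗code σ F codes (suc i) = codes i

-- Pipe dreams

module _ {n} (σ : Permutation′ n) where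

  pbott-row : ℕ → List Cell
  pbott-row i = map (i ,_) (map suc (upTo (code σ i)))

  ∈-Pbott⁺ : ∀ {r c} → 0 < c → c ≤ code σ r → (r , c) ∈ Pbott σ
  ∈-Pbott⁺ {zero} c>0 c≤0 = ⊥-elim (<⇒≱ c>0 c≤0)
  ∈-Pbott⁺ {suc k} {suc c} _ c<code =
    ∈-concatMap⁺ pbott-row (Any.map (λ { refl → ∈-map⁺ (suc k ,_) (∈-map⁺ suc (∈-upTo⁺ c<code)) })
                                    (∈-map⁺ suc (∈-upTo⁺ k<n)))
    where k<n = lehmerℕ>0⇒< (extend σ) n k (subst (0 <_) (code-suc σ k) (<-≤-trans z<s c<code))

  ∈-Pbott⁻ : ∀ {r c} → (r , c) ∈ Pbott σ → 0 < c × c ≤ code σ r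
  ∈-Pbott⁻ rc∈ with Any.satisfied (∈-concatMap⁻ pbott-row {xs = map suc (upTo n)} rc∈)
  ... | i , rc∈pbott-row with ∈-map⁻ (i ,_) rc∈pbott-row
  ... | c , c∈ , refl with ∈-map⁻ suc c∈
  ... | c′ , c′∈ , refl = z<s , ∈-upTo⁻ c′∈

module SoloLadder (P : List Cell) (L : ℕ → ℕ) (full : ∀ {r c} → 0 < c → c ≤ L r → (r , c) ∈ P)
                  (X : Cell) where

  solo-moved-∈ : ∀ {pos ms pos′} → Moves P pos ms pos′ → All (_≡ X) ms → pos′ X ≢ pos X → X ∈ P
  solo-moved-∈ done _ unmoved = ⊥-elim (unmoved refl)
  solo-moved-∈ (step (ladder _ _ X∈P _ _ _ _ _ _) _) (refl ∷ _) _ = X∈P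

  solo-moves-fix : ∀ {pos ms pos′} → Moves P pos ms pos′ → All (_≡ X) ms →
                   ∀ {y} → y ≢ X → pos′ y ≡ pos y
  solo-moves-fix done _ _ = refl
  solo-moves-fix (step (ladder _ _ _ _ _ _ _ _ others) rest) (refl ∷ solo) {y} y≢X =
    trans (solo-moves-fix rest solo y≢X) (others y y≢X)

  free-cell⇒short-row : ∀ {pos r c} → (∀ {y} → y ≢ X → pos y ≡ y) → (r , c) ≢ X → 0 < c →
                        ¬ Occ P pos (r , c) → L r < c
  free-cell⇒short-row {r = r} {c} fixed rc≢X c>0 free with L r <? c
  ... | yes Lr<c = Lr<c
  ... | no Lr≮c = ⊥-elim (free (lose (full c>0 (≮⇒≥ Lr≮c)) (fixed rc≢X)))

  -- Moving from row r + 1 to row r needs the cell (r, c) directly above to be free,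
  -- so row r is shorter than c.
  solo-moves-rows : ∀ {pos ms pos′} → Moves P pos ms pos′ → All (_≡ X) ms → (∀ {y} → y ≢ X → pos y ≡ y) →
    ∀ {R C} → pos X ≡ (R , C) → R + C ≡ proj₁ X + proj₂ X → 0 < C →
    ∀ {r} → proj₁ (pos′ X) ≤ r → r < R → suc r + L r < proj₁ X + proj₂ X
  solo-moves-rows done _ _ posX _ _ final≤r r<R = ⊥-elim (<⇒≱ r<R (subst (_≤ _) (cong proj₁ posX) final≤r))
  solo-moves-rows (step (ladder r c _ posX≡ free _ _ pos₁X≡ others) rest) (refl ∷ solo) fixed posX R+C≡S C>0
                  {r′} final≤r′ r′<R with trans (sym posX) posX≡
  ... | refl with m≤n⇒m<n∨m≡n (s≤s⁻¹ r′<R)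
  ...   | inj₁ r′<r+1 = solo-moves-rows rest solo (λ {y} y≢X → trans (others y y≢X) (fixed y≢X)) pos₁X≡
                          (trans (+-suc (suc r) c) R+C≡S) z<s final≤r′ r′<r+1
  ...   | inj₂ refl = subst (suc (suc r) + L (suc r) <_) R+C≡S
                          (+-monoʳ-< (suc (suc r)) (free-cell⇒short-row fixed above≢X C>0 free))
    where
    above≢X : (suc r , c) ≢ X
    above≢X refl = 1+n≢n R+C≡S

lemma5p4 : ∀ {n} (σ : Permutation′ n) (F : Forest) →
    (∀ i → codeF F (suc i) ≡ code σ (suc i)) →
    (a b : IN F) → RightChildV a b →
    BadPair σ a b →
    OnlyBMoves σ a b →
    Contains σ (2 ∷ 4 ∷ 1 ∷ 3 ∷ []) ⊎ Contains σ (2 ∷ 4 ∷ 3 ∷ 1 ∷ [])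
      ⊎ Contains σ (3 ∷ 2 ∷ 1 ∷ 5 ∷ 4 ∷ []) ⊎ Contains σ (3 ∷ 4 ∷ 1 ∷ 2 ∷ 6 ∷ 5 ∷ [])
lemma5p4 σ F codes a b a-b _ (_ , pos , solo , moves , same-row) =
  contains-patterns σ (code-window-patterns σ (ρV>0 a) i<j q>0 q≤code rows j≤)
  where
  open SoloLadder (Pbott σ) (code σ) (∈-Pbott⁺ σ) (cross b)
  i<j = proj₁ (right-child-code a-b)
  j≤ = subst (λ xs → ρ b ≤ ρ a + sum xs) (map-cong (codeF≗code σ F codes) (range (ρ a) (ρ b ∸ ρ a)))
             (proj₂ (right-child-code a-b))
  a-fixed : pos (cross a) ≡ cross a
  a-fixed = solo-moves-fix moves solo (<⇒≢ i<j ∘ cong proj₁)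
  b-row : proj₁ (pos (cross b)) ≡ ρ a
  b-row = trans same-row (cong proj₁ a-fixed)
  b∈ = ∈-Pbott⁻ σ (solo-moved-∈ moves solo λ b-fixed → <⇒≢ i<j (trans (sym b-row) (cong proj₁ b-fixed)))
  q>0 = proj₁ b∈
  q≤code = proj₂ b∈
  rows : ∀ {r} → ρ a ≤ r → r < ρ b → suc r + code σ r < ρ b + levelV b
  rows i≤r = solo-moves-rows moves solo (λ _ → refl) refl refl q>0 (subst (_≤ _) (sym b-row) i≤r)
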